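{- Let $x,y_1,y_2\in\Sigma^+$ with $|y_1|=|y_2|$, and let $f$ be an equivalence map. Suppose $f(xy_1)=y_1x$, and either $f(x^Ry_2)=y_2x^R$ or $f(y_2x)=xy_2$. Then either $|x|\le|y_1|=|y_2|$ or $\Sigma[x]\cap\Sigma[y_2]\ne\emptyset$.
   Context: Alphabet $\Sigma=\mathbb{N}$; $\Sigma^+$ is the set of nonempty finite words over $\Sigma$, $|w|$ is length, $w^R$ the reverse, $\Sigma[w]$ the set of symbols occurring in $w$. An equivalence map is a morphism of $\Sigma^*$ (the free monoid on $\Sigma$) induced by a bijection $\Sigma\to\Sigma$. -}

module Defs where

open import Data.Nat using (ℕ)
open import Data.List using (List; map)
open import Function.Bundles using (Bijection; _⤖_)
open import Relation.Binary.PropositionalEquality using (_≡_)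

Word : Set
Word = List ℕ

-- An equivalence map: the monoid morphism of Σ* induced by a bijection Σ → Σ.
-- We represent it by the underlying bijection g and apply it letterwise.
EquivMap : Set
EquivMap = ℕ ⤖ ℕ

apply : EquivMap → Word → Word
apply g w = map (Bijection.to g) w

-- Suppose |x| > |y₁|. Comparing the prefixes of length |x| in f(x)f(y₁) = y₁x gives
-- f(x) = y₁t and x = t f(y₁) with t nonempty, so the last letter c of f(x) occurs in x.
-- If f(y₂x) = xy₂ then, as |y₂| = |y₁| < |x|, the word y₂ is a suffix of f(x) and c occurs
-- in y₂. The other alternative f(xᴿy₂) = y₂xᴿ reverses to f(y₂ᴿx) = xy₂ᴿ, reducing it to
-- the first one with y₂ᴿ in place of y₂.
module Submission where

open import Defs
open import Data.Nat using (ℕ; _≤_; _<_; s≤s; _≤?_)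
open import Data.Nat.Properties using (<⇒≤; <⇒≢; ≰⇒>; ≤-trans; ≤-<-trans; ≤-reflexive)
open import Data.List using (List; []; _∷_; [_]; _++_; _∷ʳ_; length; reverse; map; initLast; _∷ʳ′_)
open import Data.List.Properties
  using (∷-injectiveˡ; ∷-injectiveʳ; ∷ʳ-injectiveʳ; ++-assoc; length-map; length-reverse; map-++; reverse-++; reverse-map; reverse-involutive)
open import Data.List.Membership.Propositional using (_∈_)
open import Data.List.Membership.Propositional.Properties using (∈-++⁺ˡ; ∈-++⁺ʳ)
open import Data.List.Relation.Unary.Any using (here)
open import Data.List.Relation.Unary.Any.Properties using (reverse⁻)
open import Data.Product using (Σ; _×_; _,_; ∃-syntax; ∃₂)
open import Data.Sum using (_⊎_; inj₁; inj₂)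
open import Function.Bundles using (Bijection)
open import Relation.Nullary using (yes; no; contradiction)
open import Relation.Binary.PropositionalEquality using (_≡_; _≢_; refl; sym; trans; cong; subst; module ≡-Reasoning)

module _ {a} {A : Set a} where

  ++-levi : ∀ (u v w z : List A) → length w ≤ length u → u ++ v ≡ w ++ z →
            ∃[ t ] u ≡ w ++ t × z ≡ t ++ v
  ++-levi u       v []       z _             eq = u , refl , sym eq
  ++-levi (b ∷ u) v (b′ ∷ w) z (s≤s |w|≤|u|) eq
    with refl ← ∷-injectiveˡ eq
    with t , u≡wt , z≡tv ← ++-levi u v w z |w|≤|u| (∷-injectiveʳ eq)
    = t , cong (b ∷_) u≡wt , z≡tv

  ++-overlap-last∈ : ∀ (u v w z : List A) → length w ≤ length u → length v < length z →
                     u ++ v ≡ w ++ z → ∃₂ λ p c → u ≡ p ∷ʳ c × c ∈ z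
  ++-overlap-last∈ u v w z |w|≤|u| |v|<|z| eq
    with ++-levi u v w z |w|≤|u| eq
  ... | t , u≡wt , z≡tv with initLast t
  ... | [] = contradiction (cong length (sym z≡tv)) (<⇒≢ |v|<|z|)
  ... | t′ ∷ʳ′ c =
    w ++ t′ , c , trans u≡wt (sym (++-assoc w t′ [ c ])) ,
    subst (c ∈_) (sym z≡tv) (∈-++⁺ˡ (∈-++⁺ʳ t′ (here refl)))

  ∷ʳ≡++⇒∈ : ∀ p (c : A) s y → y ≢ [] → p ∷ʳ c ≡ s ++ y → c ∈ y
  ∷ʳ≡++⇒∈ p c s y y≢[] eq with initLast y
  ... | [] = contradiction refl y≢[]
  ... | y′ ∷ʳ′ d = ∈-++⁺ʳ y′ (here (∷ʳ-injectiveʳ p (s ++ y′) (trans eq (sym (++-assoc s y′ [ d ])))))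

  reverse-≢[] : {y : List A} → y ≢ [] → reverse y ≢ []
  reverse-≢[] {y} y≢[] ry≡[] = y≢[] (trans (sym (reverse-involutive y)) (cong reverse ry≡[]))

  module _ (g : A → A) where

    map-swap-reverse : ∀ u v → map g (u ++ v) ≡ v ++ u →
                       map g (reverse v ++ reverse u) ≡ reverse u ++ reverse v
    map-swap-reverse u v eq = begin
      map g (reverse v ++ reverse u) ≡⟨ cong (map g) (sym (reverse-++ u v)) ⟩
      map g (reverse (u ++ v))       ≡⟨ reverse-map g (u ++ v) ⟩
      reverse (map g (u ++ v))       ≡⟨ cong reverse eq ⟩
      reverse (v ++ u)               ≡⟨ reverse-++ v u ⟩
      reverse u ++ reverse v         ∎
      where open ≡-Reasoning

    map-swap-common-letter : ∀ x y₁ y → y ≢ [] → length y₁ < length x → length y ≤ length x →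
                             map g (x ++ y₁) ≡ y₁ ++ x → map g (y ++ x) ≡ x ++ y →
                             ∃[ c ] c ∈ x × c ∈ y
    map-swap-common-letter x y₁ y y≢[] |y₁|<|x| |y|≤|x| e₁ e
      with p , c , gx≡pc , c∈x ←
             ++-overlap-last∈ (map g x) (map g y₁) y₁ x
               (≤-trans (<⇒≤ |y₁|<|x|) (≤-reflexive (sym (length-map g x))))
               (≤-<-trans (≤-reflexive (length-map g y₁)) |y₁|<|x|)
               (trans (sym (map-++ g x y₁)) e₁)
      with s , _ , gx≡sy ←
             ++-levi x y (map g y) (map g x) (≤-trans (≤-reflexive (length-map g y)) |y|≤|x|)
               (sym (trans (sym (map-++ g y x)) e))
      = c , c∈x , ∷ʳ≡++⇒∈ p c s y y≢[] (trans (sym gx≡pc) gx≡sy)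

lemma2p7 : (x y₁ y₂ : Word) → x ≢ [] → y₁ ≢ [] → y₂ ≢ [] →
    length y₁ ≡ length y₂ → (f : EquivMap) →
    apply f (x ++ y₁) ≡ y₁ ++ x →
    (apply f (reverse x ++ y₂) ≡ y₂ ++ reverse x) ⊎ (apply f (y₂ ++ x) ≡ x ++ y₂) →
    (length x ≤ length y₁ × length y₁ ≡ length y₂) ⊎ Σ ℕ (λ a → a ∈ x × a ∈ y₂)
lemma2p7 x y₁ y₂ _ _ y₂≢[] |y₁|≡|y₂| f fxy₁≡y₁x fy₂ with length x ≤? length y₁
... | yes |x|≤|y₁| = inj₁ (|x|≤|y₁| , |y₁|≡|y₂|)
... | no |x|≰|y₁| = inj₂ (common-letter fy₂)
  where
  g : ℕ → ℕ
  g = Bijection.to f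

  |y₁|<|x| : length y₁ < length x
  |y₁|<|x| = ≰⇒> |x|≰|y₁|

  |y₂|≤|x| : length y₂ ≤ length x
  |y₂|≤|x| = ≤-trans (≤-reflexive (sym |y₁|≡|y₂|)) (<⇒≤ |y₁|<|x|)

  common-letter : (apply f (reverse x ++ y₂) ≡ y₂ ++ reverse x) ⊎ (apply f (y₂ ++ x) ≡ x ++ y₂) →
                  ∃[ c ] c ∈ x × c ∈ y₂
  common-letter (inj₂ fy₂x≡xy₂) =
    map-swap-common-letter g x y₁ y₂ y₂≢[] |y₁|<|x| |y₂|≤|x| fxy₁≡y₁x fy₂x≡xy₂
  common-letter (inj₁ fxᴿy₂≡y₂xᴿ)
    with c , c∈x , c∈y₂ᴿ ←
           map-swap-common-letter g x y₁ (reverse y₂) (reverse-≢[] y₂≢[]) |y₁|<|x|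
             (≤-trans (≤-reflexive (length-reverse y₂)) |y₂|≤|x|) fxy₁≡y₁x
             (subst (λ u → map g (reverse y₂ ++ u) ≡ u ++ reverse y₂) (reverse-involutive x)
               (map-swap-reverse g (reverse x) y₂ fxᴿy₂≡y₂xᴿ))
    = c , c∈x , reverse⁻ c∈y₂ᴿ
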